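{- Let $\lambda$ be a nonempty partition with $\ell$ parts and largest part $\lambda_1$, and let $w_0w_1\cdots w_{L-1}$, $L=\lambda_1+\ell$, be its profile word in the letters $E$ (east step) and $N$ (north step). Let $s$ be a positive integer with $s<L$ such that (i) among the letters $w_0,\dots,w_{L-s-1}$ there are strictly more $E$'s than $N$'s, and (ii) among the letters $w_s,\dots,w_{L-1}$ there are strictly more $N$'s than $E$'s. Then $s\in Hk(\lambda)$. Consequently, if $\{s_i\}$ is any set of positive integers each of which satisfies (i) and (ii), then $\{s_i\}\subseteq Hk(\lambda)$.
   Context: For a partition $\lambda=(\lambda_1\ge\dots\ge\lambda_\ell\ge1)$, the hook length of cell $(i,j)$ ($1\le i\le \ell$, $1\le j\le\lambda_i$) is $h_{ij}=\lambda_i-j+\lambda'_j-i+1$ with $\lambda'_j=|\{a:\lambda_a\ge j\}|$, and $Hk(\lambda)$ is the set of all hook lengths. The profile of $\lambda$ is the lattice path along the outer (southmost and eastmost) boundary of its Young diagram (drawn in English notation, rows top to bottom), traversed from the bottom-left corner to the top-right corner; it consists of $\lambda_1$ east steps $E$ and $\ell$ north steps $N$, begins with $E$ and ends with $N$. Reading it gives the word $w_0\cdots w_{L-1}$, and the hook lengths of $\lambda$ are exactly the numbers $q-p$ with $p<q$, $w_p=E$, $w_q=N$. Conditions (i) and (ii) are the precise meaning of "the profile lies strictly above the diagonal at the points at distance $s$ from the upper and from the lower corner along the profile". -}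

module Defs where

open import Data.Nat using (ℕ; zero; suc; _+_; _∸_; _≤_; _<_; _≥_; _≤?_)
open import Data.List using (List; []; _∷_; _++_; replicate; length; filter; take; drop)
open import Data.List.Relation.Unary.All using (All)
open import Data.List.Relation.Unary.Linked using (Linked)
open import Data.Product using (Σ; _×_; ∃-syntax)
open import Relation.Binary.PropositionalEquality using (_≡_; _≢_)

record IsPartition (λs : List ℕ) : Set where
  field
    nonempty   : λs ≢ []
    positive   : All (λ a → 1 ≤ a) λs
    decreasing : Linked _≥_ λs

numParts : List ℕ → ℕ
numParts = length

-- λ_i, 1-indexed (0 outside the range 1..ℓ)
partAt : List ℕ → ℕ → ℕ
partAt []       _             = 0
partAt (a ∷ as) zero          = 0
partAt (a ∷ as) (suc zero)    = a
partAt (a ∷ as) (suc (suc i)) = partAt as (suc i)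

conj : List ℕ → ℕ → ℕ
conj λs j = length (filter (j ≤?_) λs)

-- hook length h_ij = λ_i - j + λ'_j - i + 1 (for a cell, this is a natural number)
hook : List ℕ → ℕ → ℕ → ℕ
hook λs i j = (partAt λs i + conj λs j + 1) ∸ (i + j)

InHk : List ℕ → ℕ → Set
InHk λs h = ∃[ i ] ∃[ j ] (1 ≤ i × i ≤ numParts λs × 1 ≤ j × j ≤ partAt λs i × h ≡ hook λs i j)

data Letter : Set where
  E N : Letter

-- Profile word, from the bottom-left corner to the top-right corner:
-- E^{λ_ℓ} N E^{λ_{ℓ-1}-λ_ℓ} N ⋯ E^{λ_1-λ_2} N.
profile : List ℕ → List Letter
profile []           = []
profile (a ∷ [])     = replicate a E ++ (N ∷ [])
profile (a ∷ b ∷ as) = profile (b ∷ as) ++ (replicate (a ∸ b) E ++ (N ∷ []))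

countE : List Letter → ℕ
countE []       = 0
countE (E ∷ w)  = suc (countE w)
countE (N ∷ w)  = countE w

countN : List Letter → ℕ
countN []       = 0
countN (E ∷ w)  = countN w
countN (N ∷ w)  = suc (countN w)

condI : List Letter → ℕ → Set
condI w s = countN (take (length w ∸ s) w) < countE (take (length w ∸ s) w)

condII : List Letter → ℕ → Set
condII w s = countE (drop s w) < countN (drop s w)

module Submission where

-- Write w for the profile of λ and L for its length.  Condition (i)
-- says that the prefix u = w₀⋯w_{L-s-1} has more E's than N's, condition (ii)
-- that the suffix v = w_s⋯w_{L-1} has more N's than E's.  Both words have
-- length L - s, so comparing 2·#E(v) < |v| = |u| < 2·#E(u) gives #E(v) < #E(u).
-- Two words of equal length in which the first has more E's must have a
-- position p where the first reads E and the second reads N; i.e. w_p = E and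
-- w_{s+p} = N.  Hence it suffices to show that every pair p < q with w_p = E,
-- w_q = N yields the hook length q - p.

open import Defs
open import Data.Nat using (ℕ; zero; suc; _≤_; _<_; _+_; _∸_; _≥_; _≤?_; _<?_; _⊓_; z≤n; s≤s)
open import Data.Nat.Properties
open import Data.Nat.Tactic.RingSolver using (solve-∀)
open import Data.List using (List; []; _∷_; _++_; length; replicate; take; drop)
open import Data.List.Properties
  using (filter-accept; filter-reject; length-++; length-take; length-drop; length-replicate)
open import Data.List.Relation.Unary.All using (All; []; _∷_)
import Data.List.Relation.Unary.All as All
open import Data.List.Relation.Unary.Linked using (Linked)
import Data.List.Relation.Unary.Linked as Linked
open import Data.List.Relation.Unary.Linked.Properties using (Linked⇒All)
open import Data.Maybe using (Maybe; just; nothing)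
open import Data.Product using (_×_; _,_; ∃-syntax)
open import Data.Sum using (_⊎_; inj₁; inj₂)
open import Data.Empty using (⊥-elim)
open import Relation.Nullary using (yes; no; ¬_)
open import Relation.Binary.PropositionalEquality

infixl 9 _‼_
_‼_ : {A : Set} → List A → ℕ → Maybe A
[]       ‼ _     = nothing
(x ∷ xs) ‼ zero  = just x
(x ∷ xs) ‼ suc p = xs ‼ p

‼-take : {A : Set} (m : ℕ) (w : List A) (p : ℕ) {x : A} →
  take m w ‼ p ≡ just x → w ‼ p ≡ just x
‼-take (suc m) (y ∷ w) zero    e = e
‼-take (suc m) (y ∷ w) (suc p) e = ‼-take m w p e

‼-drop : {A : Set} (s : ℕ) (w : List A) (p : ℕ) → drop s w ‼ p ≡ w ‼ (s + p)
‼-drop zero    w       p = refl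
‼-drop (suc s) []      p = refl
‼-drop (suc s) (y ∷ w) p = ‼-drop s w p

‼-++ : {A : Set} (xs ys : List A) (p : ℕ) {x : A} → (xs ++ ys) ‼ p ≡ just x →
  (xs ‼ p ≡ just x) ⊎ (∃[ r ] (p ≡ length xs + r × ys ‼ r ≡ just x))
‼-++ []       ys p       e = inj₂ (p , refl , e)
‼-++ (y ∷ xs) ys zero    e = inj₁ e
‼-++ (y ∷ xs) ys (suc p) e with ‼-++ xs ys p e
... | inj₁ e′            = inj₁ e′
... | inj₂ (r , eq , e′) = inj₂ (r , cong suc eq , e′)

count-split : (w : List Letter) → countE w + countN w ≡ length w
count-split []      = refl
count-split (E ∷ w) = cong suc (count-split w)
count-split (N ∷ w) = trans (+-suc (countE w) (countN w)) (cong suc (count-split w))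

mismatch : (xs ys : List Letter) → length xs ≡ length ys → countE ys < countE xs →
  ∃[ p ] (xs ‼ p ≡ just E × ys ‼ p ≡ just N)
mismatch (E ∷ xs) (N ∷ ys) _  _ = 0 , refl , refl
mismatch (E ∷ xs) (E ∷ ys) eq lt =
  let p , h = mismatch xs ys (suc-injective eq) (<-pred lt) in suc p , h
mismatch (N ∷ xs) (E ∷ ys) eq lt =
  let p , h = mismatch xs ys (suc-injective eq) (<-trans (n<1+n _) lt) in suc p , h
mismatch (N ∷ xs) (N ∷ ys) eq lt =
  let p , h = mismatch xs ys (suc-injective eq) lt in suc p , h

half-< : ∀ a b → a + a < b + b → a < b
half-< a b h with a <? b
... | yes a<b = a<b
... | no  a≮b = ⊥-elim (<⇒≱ h (+-mono-≤ (≮⇒≥ a≮b) (≮⇒≥ a≮b)))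

east-north-at-distance : (w : List Letter) (s : ℕ) → condI w s → condII w s →
  ∃[ p ] (w ‼ p ≡ just E × w ‼ (s + p) ≡ just N)
east-north-at-distance w s cI cII =
  let p , inPrefix , inSuffix = mismatch prefix suffix same-length fewer-E
  in p , ‼-take (length w ∸ s) w p inPrefix , trans (sym (‼-drop s w p)) inSuffix
  where
  prefix = take (length w ∸ s) w
  suffix = drop s w
  same-length : length prefix ≡ length suffix
  same-length = begin
    length prefix             ≡⟨ length-take (length w ∸ s) w ⟩
    (length w ∸ s) ⊓ length w ≡⟨ m≤n⇒m⊓n≡m (m∸n≤m (length w) s) ⟩
    length w ∸ s              ≡⟨ sym (length-drop s w) ⟩
    length suffix             ∎
    where open ≡-Reasoning
  fewer-E : countE suffix < countE prefix
  fewer-E = half-< _ _ (begin-strict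
    countE suffix + countE suffix <⟨ +-monoʳ-< (countE suffix) cII ⟩
    countE suffix + countN suffix ≡⟨ count-split suffix ⟩
    length suffix                 ≡⟨ sym same-length ⟩
    length prefix                 ≡⟨ sym (count-split prefix) ⟩
    countE prefix + countN prefix <⟨ +-monoʳ-< (countE prefix) cI ⟩
    countE prefix + countE prefix ∎)
    where open ≤-Reasoning

Decreasing : List ℕ → Set
Decreasing = Linked _≥_

bounded-by-head : ∀ {a as} → Decreasing (a ∷ as) → All (_≤ a) (a ∷ as)
bounded-by-head = Linked⇒All (λ x≥y y≥z → ≤-trans y≥z x≥y) ≤-refl

Block : ℕ → List Letter
Block k = replicate k E ++ N ∷ []

‼-Block : ∀ k r {x} → Block k ‼ r ≡ just x → (x ≡ E × r < k) ⊎ (x ≡ N × r ≡ k)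
‼-Block zero    zero    refl = inj₂ (refl , refl)
‼-Block zero    (suc r) ()
‼-Block (suc k) zero    refl = inj₁ (refl , s≤s z≤n)
‼-Block (suc k) (suc r) e with ‼-Block k r e
... | inj₁ (x≡E , r<k) = inj₁ (x≡E , s≤s r<k)
... | inj₂ (x≡N , r≡k) = inj₂ (x≡N , cong suc r≡k)

length-Block : ∀ k → length (Block k) ≡ k + 1
length-Block k = trans (length-++ (replicate k E)) (cong (_+ 1) (length-replicate k))

length-profile : ∀ a as → Decreasing (a ∷ as) →
  length (profile (a ∷ as)) ≡ a + length (a ∷ as)
length-profile a []       _   = length-Block a
length-profile a (b ∷ as) dec = begin
  length (profile (b ∷ as) ++ Block (a ∸ b))
    ≡⟨ length-++ (profile (b ∷ as)) ⟩
  length (profile (b ∷ as)) + length (Block (a ∸ b))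
    ≡⟨ cong₂ _+_ (length-profile b as (Linked.tail dec)) (length-Block (a ∸ b)) ⟩
  (b + length (b ∷ as)) + ((a ∸ b) + 1)
    ≡⟨ regroup b (length (b ∷ as)) (a ∸ b) ⟩
  (b + (a ∸ b)) + length (a ∷ b ∷ as)
    ≡⟨ cong (_+ length (a ∷ b ∷ as)) (m+[n∸m]≡n (Linked.head dec)) ⟩
  a + length (a ∷ b ∷ as) ∎
  where
  open ≡-Reasoning
  regroup : ∀ x y z → (x + y) + (z + 1) ≡ (x + z) + suc y
  regroup = solve-∀

‼-profile-cons : ∀ a b as → Decreasing (b ∷ as) → ∀ p {x} →
  profile (a ∷ b ∷ as) ‼ p ≡ just x →
  (profile (b ∷ as) ‼ p ≡ just x) ⊎
  (∃[ r ] (p ≡ b + length (b ∷ as) + r × Block (a ∸ b) ‼ r ≡ just x))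
‼-profile-cons a b as dec p e with ‼-++ (profile (b ∷ as)) (Block (a ∸ b)) p e
... | inj₁ e′            = inj₁ e′
... | inj₂ (r , eq , e′) =
  inj₂ (r , trans eq (cong (_+ r) (length-profile b as dec)) , e′)

conj-accept : ∀ a as j → j ≤ a → conj (a ∷ as) j ≡ suc (conj as j)
conj-accept a as j j≤a = cong length (filter-accept (j ≤?_) {a} {as} j≤a)

conj-reject : ∀ a as j → ¬ j ≤ a → conj (a ∷ as) j ≡ conj as j
conj-reject a as j j≰a = cong length (filter-reject (j ≤?_) {a} {as} j≰a)

conj-cons-≤ : ∀ a as j → conj (a ∷ as) j ≤ suc (conj as j)
conj-cons-≤ a as j with j ≤? a
... | yes j≤a = ≤-reflexive (conj-accept a as j j≤a)
... | no  j≰a = ≤-trans (≤-reflexive (conj-reject a as j j≰a)) (n≤1+n _)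

conj-vanish : ∀ as j → All (_< j) as → conj as j ≡ 0
conj-vanish []       j []         = refl
conj-vanish (a ∷ as) j (a<j ∷ hs) = trans (conj-reject a as j (<⇒≱ a<j)) (conj-vanish as j hs)

conj<row : ∀ a as → Decreasing (a ∷ as) → ∀ i j → 1 ≤ i → i ≤ length (a ∷ as) →
  partAt (a ∷ as) i < j → conj (a ∷ as) j < i
conj<row a as dec (suc zero) j _ _ a<j =
  subst (_< 1) (sym (trans (conj-reject a as j (<⇒≱ a<j)) (conj-vanish as j below))) (s≤s z≤n)
  where
  below : All (_< j) as
  below with bounded-by-head dec
  ... | _ ∷ parts≤a = All.map (λ x≤a → ≤-<-trans x≤a a<j) parts≤a
conj<row a (b ∷ as) dec (suc (suc i)) j _ (s≤s i<ℓ) λᵢ<j =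
  ≤-<-trans (conj-cons-≤ a (b ∷ as) j)
            (s≤s (conj<row b as (Linked.tail dec) (suc i) j (s≤s z≤n) i<ℓ λᵢ<j))

-- An E-step at position p is the bottom edge of some column j of λ, and its
-- position is p = ℓ + j - 1 - λ'_j.
east-step-column : ∀ a as → Decreasing (a ∷ as) → ∀ p → profile (a ∷ as) ‼ p ≡ just E →
  ∃[ j ] (1 ≤ j × j ≤ a × p + conj (a ∷ as) j + 1 ≡ length (a ∷ as) + j)
east-step-column a [] _ p e with ‼-Block a p e
... | inj₂ (() , _)
... | inj₁ (_ , p<a) =
  suc p , s≤s z≤n , p<a , trans (cong (λ c → p + c + 1) (conj-accept a [] (suc p) p<a)) (arith p)
  where
  arith : ∀ p → p + 1 + 1 ≡ 1 + suc p
  arith = solve-∀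
east-step-column a (b ∷ as) dec p e with ‼-profile-cons a b as (Linked.tail dec) p e
... | inj₁ e′ =
  let j , 1≤j , j≤b , eq = east-step-column b as (Linked.tail dec) p e′
      j≤a = ≤-trans j≤b (Linked.head dec)
  in j , 1≤j , j≤a ,
     trans (cong (λ c → p + c + 1) (conj-accept a (b ∷ as) j j≤a))
           (trans (cong (_+ 1) (+-suc p _)) (cong suc eq))
... | inj₂ (r , refl , e′) with ‼-Block (a ∸ b) r e′
...   | inj₂ (() , _)
...   | inj₁ (_ , r<a-b) =
  j , s≤s z≤n , j≤a ,
  trans (cong (λ c → b + n + r + c + 1)
          (trans (conj-accept a (b ∷ as) j j≤a) (cong suc (conj-vanish (b ∷ as) j below))))
        (arith b n r)
  where
  n = length (b ∷ as)
  j = suc (b + r)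
  j≤a : j ≤ a
  j≤a = subst (j ≤_) (m+[n∸m]≡n (Linked.head dec))
          (subst (_≤ b + (a ∸ b)) (+-suc b r) (+-monoʳ-≤ b r<a-b))
  below : All (_< j) (b ∷ as)
  below = All.map (λ x≤b → s≤s (≤-trans x≤b (m≤m+n b r))) (bounded-by-head (Linked.tail dec))
  arith : ∀ b n r → b + n + r + 1 + 1 ≡ suc n + suc (b + r)
  arith = solve-∀

-- An N-step at position q is the right edge of some row i of λ, and its
-- position is q = λ_i + ℓ - i.
north-step-row : ∀ a as → Decreasing (a ∷ as) → ∀ q → profile (a ∷ as) ‼ q ≡ just N →
  ∃[ i ] (1 ≤ i × i ≤ length (a ∷ as) × q + i ≡ partAt (a ∷ as) i + length (a ∷ as))
north-step-row a [] _ q e with ‼-Block a q e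
... | inj₁ (() , _)
... | inj₂ (_ , refl) = 1 , s≤s z≤n , s≤s z≤n , refl
north-step-row a (b ∷ as) dec q e with ‼-profile-cons a b as (Linked.tail dec) q e
... | inj₁ e′ with north-step-row b as (Linked.tail dec) q e′
...   | suc i , _ , i≤ℓ , eq =
  suc (suc i) , s≤s z≤n , s≤s i≤ℓ ,
  trans (+-suc q (suc i)) (trans (cong suc eq) (sym (+-suc _ _)))
north-step-row a (b ∷ as) dec q e | inj₂ (r , refl , e′) with ‼-Block (a ∸ b) r e′
... | inj₁ (() , _)
... | inj₂ (_ , refl) =
  1 , s≤s z≤n , s≤s z≤n ,
  trans (arith b (length (b ∷ as)) (a ∸ b))
        (cong (_+ length (a ∷ b ∷ as)) (m+[n∸m]≡n (Linked.head dec)))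
  where
  arith : ∀ b n r → b + n + r + 1 ≡ (b + r) + suc n
  arith = solve-∀

column-within-row : ∀ a as → Decreasing (a ∷ as) → ∀ p q i j → 1 ≤ i → i ≤ length (a ∷ as) →
  p + conj (a ∷ as) j + 1 ≡ length (a ∷ as) + j →
  q + i ≡ partAt (a ∷ as) i + length (a ∷ as) → p ≤ q → j ≤ partAt (a ∷ as) i
column-within-row a as dec p q i j 1≤i i≤ℓ column row p≤q with j ≤? partAt (a ∷ as) i
... | yes j≤λᵢ = j≤λᵢ
... | no  j≰λᵢ = ⊥-elim (<-irrefl refl (begin-strict
  λᵢ + ℓ        ≡⟨ +-comm λᵢ ℓ ⟩
  ℓ + λᵢ        <⟨ +-monoʳ-< ℓ (≰⇒> j≰λᵢ) ⟩
  ℓ + j         ≡⟨ sym column ⟩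
  p + λ'ⱼ + 1   ≡⟨ trans (+-assoc p λ'ⱼ 1) (cong (p +_) (+-comm λ'ⱼ 1)) ⟩
  p + suc λ'ⱼ   ≤⟨ +-mono-≤ p≤q (conj<row a as dec i j 1≤i i≤ℓ (≰⇒> j≰λᵢ)) ⟩
  q + i         ≡⟨ row ⟩
  λᵢ + ℓ        ∎))
  where
  open ≤-Reasoning
  ℓ = length (a ∷ as)
  λᵢ = partAt (a ∷ as) i
  λ'ⱼ = conj (a ∷ as) j

hook-from-steps : ∀ λs p s i j →
  p + conj λs j + 1 ≡ numParts λs + j →
  s + p + i ≡ partAt λs i + numParts λs → hook λs i j ≡ s
hook-from-steps λs p s i j column row = begin
  (λᵢ + λ'ⱼ + 1) ∸ (i + j) ≡⟨ cong (_∸ (i + j)) (+-cancelʳ-≡ (p + ℓ) _ _ sum) ⟩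
  s + (i + j) ∸ (i + j)   ≡⟨ m+n∸n≡m s (i + j) ⟩
  s                       ∎
  where
  open ≡-Reasoning
  ℓ = numParts λs
  λᵢ = partAt λs i
  λ'ⱼ = conj λs j
  sum : λᵢ + λ'ⱼ + 1 + (p + ℓ) ≡ s + (i + j) + (p + ℓ)
  sum = begin
    λᵢ + λ'ⱼ + 1 + (p + ℓ)   ≡⟨ regroup₁ λᵢ λ'ⱼ p ℓ ⟩
    (λᵢ + ℓ) + (p + λ'ⱼ + 1) ≡⟨ cong₂ _+_ (sym row) column ⟩
    (s + p + i) + (ℓ + j)    ≡⟨ regroup₂ s p i ℓ j ⟩
    s + (i + j) + (p + ℓ)    ∎
    where
    regroup₁ : ∀ x c p ℓ → x + c + 1 + (p + ℓ) ≡ (x + ℓ) + (p + c + 1)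
    regroup₁ = solve-∀
    regroup₂ : ∀ s p i ℓ j → (s + p + i) + (ℓ + j) ≡ s + (i + j) + (p + ℓ)
    regroup₂ = solve-∀

hook-of-conditions : ∀ λs → IsPartition λs → ∀ s →
  condI (profile λs) s → condII (profile λs) s → InHk λs s
hook-of-conditions []       isP = ⊥-elim (IsPartition.nonempty isP refl)
hook-of-conditions (a ∷ as) isP s cI cII =
  let p , atE , atN           = east-north-at-distance (profile (a ∷ as)) s cI cII
      j , 1≤j , _ , column    = east-step-column a as dec p atE
      i , 1≤i , i≤ℓ , row     = north-step-row a as dec (s + p) atN
  in i , j , 1≤i , i≤ℓ , 1≤j ,
     column-within-row a as dec p (s + p) i j 1≤i i≤ℓ column row (m≤n+m p s) ,
     sym (hook-from-steps (a ∷ as) p s i j column row)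
  where dec = IsPartition.decreasing isP

theorem3 : (λs : List ℕ) → IsPartition λs →
    ((s : ℕ) → 1 ≤ s → s < length (profile λs) →
      condI (profile λs) s → condII (profile λs) s → InHk λs s)
    ×
    ((S : ℕ → Set) →
      ((s : ℕ) → S s → 1 ≤ s × condI (profile λs) s × condII (profile λs) s) →
      (s : ℕ) → S s → InHk λs s)
theorem3 λs isP =
  (λ s _ _ cI cII → hook-of-conditions λs isP s cI cII) ,
  (λ S conditions s s∈S →
     let _ , cI , cII = conditions s s∈S in hook-of-conditions λs isP s cI cII)
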